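{- Let $n=6k+1$ for a positive integer $k$ and let $\xi$ be a primitive element of $\mathbb{F}_{2^n}$. For every $a\in\mathbb{Z}_{2^n-1}\setminus\{0\}$, the set $\Gamma(a)$ consists of six elements lying in six pairwise distinct $2$-cyclotomic classes, all of the same size.
   Context: Elements of $\mathbb{Z}_{2^n-1}$ are exponents of $\xi$. For nonzero $a$, the Zech logarithm $\mathrm{Z}(a)$ is defined by $1+\xi^a=\xi^{\mathrm{Z}(a)}$ and $\Gamma(a)=\{a,\mathrm{Z}(a),\mathrm{Z}(-a),-\mathrm{Z}(-a),-\mathrm{Z}(a),-a\}$. The $2$-cyclotomic class of $a$ is $\{2^ia \bmod (2^n-1): i\ge0\}$. -}

module Defs where

open import Level using (Level; _⊔_)
open import Data.Nat using (ℕ; zero; suc; _+_; _*_; _∸_; _^_; _≟_)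
open import Data.Nat.DivMod using (_%_)
open import Data.Fin using (Fin)
open import Data.List using (List; length; map; upTo; deduplicate)
open import Data.Product using (Σ; ∃; _×_)
open import Relation.Nullary using (¬_)
open import Relation.Binary.PropositionalEquality as ≡ using (_≡_)
open import Algebra.Bundles using (CommutativeRing)
open import Function.Bundles using (Bijection)

-- remainder, with the convention a mod 0 = a (only used for nonzero moduli)
_%′_ : ℕ → ℕ → ℕ
a %′ zero = a
a %′ suc m = a % suc m

-- the modulus 2^n - 1 ; exponents in Z_{2^n-1} are represented by ℕ below it
modulus : ℕ → ℕ
modulus n = 2 ^ n ∸ 1

neg : ℕ → ℕ → ℕ
neg n a = (modulus n ∸ a) %′ modulus n

cyc : ℕ → ℕ → ℕ → ℕ
cyc n a i = (2 ^ i * a) %′ modulus n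

InClass : ℕ → ℕ → ℕ → Set
InClass n a b = ∃ λ i → b ≡ cyc n a i

-- size of the 2-cyclotomic class {2^i a mod (2^n-1) : i ≥ 0}
-- (as 2^n ≡ 1, the exponents i < n already give the whole class)
classSize : ℕ → ℕ → ℕ
classSize n a = length (deduplicate _≟_ (map (cyc n a) (upTo n)))

module _ {c ℓ : Level} (F : CommutativeRing c ℓ) where
  open CommutativeRing F renaming (_*_ to _·_; _+_ to _⊕_)

  pow : Carrier → ℕ → Carrier
  pow x zero = 1#
  pow x (suc m) = x · pow x m

  record IsField : Set (c ⊔ ℓ) where
    field
      0≉1 : ¬ (0# ≈ 1#)
      inverse : ∀ x → ¬ (x ≈ 0#) → ∃ λ y → x · y ≈ 1#

  HasSize : ℕ → Set (c ⊔ ℓ)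
  HasSize m = Bijection setoid (≡.setoid (Fin m))

  IsPrimitive : Carrier → Set (c ⊔ ℓ)
  IsPrimitive ξ = ∀ x → ¬ (x ≈ 0#) → ∃ λ i → x ≈ pow ξ i

-- Read as powers of ξ, the six elements of Γ(a) sit on a hexagon whose edges alternately join
-- x to 1 + x and x to x⁻¹; the identity −Z(−a) = Z(−Z(a)) closes it. Squaring preserves both
-- kinds of edge, so a power σⁱ of the Frobenius taking one vertex to another acts on the whole
-- hexagon as a colour-preserving symmetry g, and g⁶ = id. Since σⁿ = id and n ≡ 1 (mod 6),
-- every vertex x satisfies x = σⁱⁿ(x) = gⁿ(x) = g(x); if g ≠ id two vertices coincide, which
-- forces them to be 0, 1 or roots of x² + x + 1, and the last case would give σ(x) = 1 + x,
-- ruled out by the same argument. Adjacent vertices have classes of equal size because each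
-- edge relation is a bijection commuting with σ.

module Submission where

open import Defs
open import Level using (Level)
open import Data.Nat as ℕ using (ℕ; zero; suc; _+_; _*_; _∸_; _≤_; _<_; z≤n; s≤s)
import Data.Nat.Properties as ℕ
open import Data.Nat.DivMod using (_%_; _/_; m≡m%n+[m/n]*n; m%n<n)
open import Data.Fin as Fin using (Fin; toℕ; fromℕ<)
open import Data.Fin.Properties using (injective⇒≤; pigeonhole; toℕ-fromℕ<; toℕ<n)
open import Data.List using (List; []; _∷_; reverse; upTo; deduplicate)
open import Data.List.Relation.Unary.All using (All)
import Data.List.Relation.Unary.All.Properties as All
open import Data.List.Relation.Unary.AllPairs using (AllPairs)
open import Data.List.Relation.Unary.AllPairs.Properties using (tabulate⁺)
open import Data.List.Relation.Binary.Pointwise as Pointwise using (Pointwise; []; _∷_; Pointwise-length)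
open import Data.Product using (∃; ∃₂; _×_; _,_; proj₁; proj₂)
open import Data.Empty using (⊥-elim)
open import Function using (_∘_; Bijection)
import Function.Endo.Propositional as Endo
open import Relation.Nullary using (¬_; yes; no; ¬?)
open import Relation.Nullary.Decidable using (map′)
open import Relation.Binary using (Setoid; Decidable; DecidableEquality; REL; tri<; tri≈; tri>)
open import Relation.Binary.PropositionalEquality as ≡ using (_≡_; _≢_)
open import Algebra.Bundles using (CommutativeRing)

data Colour : Set where
  add-one invert : Colour

Vertex : Set
Vertex = Fin 6

pattern v₀ = Fin.zero
pattern v₁ = Fin.suc v₀
pattern v₂ = Fin.suc v₁
pattern v₃ = Fin.suc v₂
pattern v₄ = Fin.suc v₃
pattern v₅ = Fin.suc v₄

step : Colour → Vertex → Vertex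
step add-one v₀ = v₁
step add-one v₁ = v₀
step add-one v₂ = v₅
step add-one v₃ = v₄
step add-one v₄ = v₃
step add-one v₅ = v₂
step invert  v₀ = v₅
step invert  v₁ = v₄
step invert  v₂ = v₃
step invert  v₃ = v₂
step invert  v₄ = v₁
step invert  v₅ = v₀

step-involutive : ∀ c v → step c (step c v) ≡ v
step-involutive add-one v₀ = ≡.refl
step-involutive add-one v₁ = ≡.refl
step-involutive add-one v₂ = ≡.refl
step-involutive add-one v₃ = ≡.refl
step-involutive add-one v₄ = ≡.refl
step-involutive add-one v₅ = ≡.refl
step-involutive invert  v₀ = ≡.refl
step-involutive invert  v₁ = ≡.refl
step-involutive invert  v₂ = ≡.refl
step-involutive invert  v₃ = ≡.refl
step-involutive invert  v₄ = ≡.refl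
step-involutive invert  v₅ = ≡.refl

walk : List Colour → Vertex → Vertex
walk []      v = v
walk (c ∷ w) v = walk w (step c v)

walk-injective : ∀ w {x y} → walk w x ≡ walk w y → x ≡ y
walk-injective []      eq = eq
walk-injective (c ∷ w) {x} {y} eq = begin
  x                 ≡⟨ step-involutive c x ⟨
  step c (step c x) ≡⟨ ≡.cong (step c) (walk-injective w eq) ⟩
  step c (step c y) ≡⟨ step-involutive c y ⟩
  y                 ∎
  where open ≡.≡-Reasoning

path : Vertex → List Colour
path v₀ = []
path v₁ = add-one ∷ []
path v₂ = invert ∷ add-one ∷ []
path v₃ = add-one ∷ invert ∷ add-one ∷ []
path v₄ = add-one ∷ invert ∷ []
path v₅ = invert ∷ []

walk-path : ∀ v → walk (path v) v₀ ≡ v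
walk-path v₀ = ≡.refl
walk-path v₁ = ≡.refl
walk-path v₂ = ≡.refl
walk-path v₃ = ≡.refl
walk-path v₄ = ≡.refl
walk-path v₅ = ≡.refl

walk-reverse-path : ∀ v → walk (reverse (path v)) v ≡ v₀
walk-reverse-path v₀ = ≡.refl
walk-reverse-path v₁ = ≡.refl
walk-reverse-path v₂ = ≡.refl
walk-reverse-path v₃ = ≡.refl
walk-reverse-path v₄ = ≡.refl
walk-reverse-path v₅ = ≡.refl

-- the colour-preserving symmetry of the hexagon taking v₀ to p
symmetry : Vertex → Vertex → Vertex
symmetry p v = walk (path v) p

module _ {a} {A : Set a} where
  open Endo A using (_^_; ^-homo)

  ^-fixes-multiples : ∀ (f : A → A) m {x} → (f ^ m) x ≡ x → ∀ k → (f ^ (m * k)) x ≡ x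
  ^-fixes-multiples f m {x} fixed zero = ≡.cong (λ j → (f ^ j) x) (ℕ.*-zeroʳ m)
  ^-fixes-multiples f m {x} fixed (suc k) = begin
    (f ^ (m * suc k)) x       ≡⟨ ≡.cong (λ j → (f ^ j) x) (ℕ.*-suc m k) ⟩
    (f ^ (m + m * k)) x       ≡⟨ ≡.cong-app (^-homo f m (m * k)) x ⟩
    (f ^ m) ((f ^ (m * k)) x) ≡⟨ ≡.cong (f ^ m) (^-fixes-multiples f m fixed k) ⟩
    (f ^ m) x                 ≡⟨ fixed ⟩
    x                         ∎
    where open ≡.≡-Reasoning

open Endo Vertex using () renaming (_^_ to _^ᵛ_)

symmetry-order : ∀ p → (symmetry p ^ᵛ 6) v₀ ≡ v₀
symmetry-order v₀ = ≡.refl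
symmetry-order v₁ = ≡.refl
symmetry-order v₂ = ≡.refl
symmetry-order v₃ = ≡.refl
symmetry-order v₄ = ≡.refl
symmetry-order v₅ = ≡.refl

symmetry-period : ∀ p k → (symmetry p ^ᵛ (6 * k + 1)) v₀ ≡ p
symmetry-period p k = begin
  (symmetry p ^ᵛ (6 * k + 1)) v₀        ≡⟨ ≡.cong (λ m → (symmetry p ^ᵛ m) v₀) (ℕ.+-comm (6 * k) 1) ⟩
  symmetry p ((symmetry p ^ᵛ (6 * k)) v₀) ≡⟨ ≡.cong (symmetry p) (^-fixes-multiples (symmetry p) 6 (symmetry-order p) k) ⟩
  symmetry p v₀                         ∎
  where open ≡.≡-Reasoning

module FiniteSetoid {a ℓ} {S : Setoid a ℓ} {q} (size : Bijection S (≡.setoid (Fin q))) where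
  open Setoid S
  open Bijection size using (to; injective; surjective) renaming (cong to to-cong)

  from : Fin q → Carrier
  from y = proj₁ (surjective y)

  to-from : ∀ y → to (from y) ≡ y
  to-from y = proj₂ (surjective y) refl

  infix 4 _≟_
  _≟_ : Decidable _≈_
  x ≟ y = map′ injective to-cong (to x Fin.≟ to y)

  size≤cover : ∀ {m} (f : Fin m → Carrier) → (∀ x → ∃ λ j → x ≈ f j) → q ≤ m
  size≤cover {m} f cover = injective⇒≤ index-injective
    where
    index : Fin q → Fin m
    index y = proj₁ (cover (from y))
    index-injective : ∀ {y y′} → index y ≡ index y′ → y ≡ y′
    index-injective {y} {y′} eq = begin
      y            ≡⟨ to-from y ⟨
      to (from y)  ≡⟨ to-cong from-y≈from-y′ ⟩
      to (from y′) ≡⟨ to-from y′ ⟩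
      y′           ∎
      where
      open ≡.≡-Reasoning
      from-y≈from-y′ : from y ≈ from y′
      from-y≈from-y′ = trans (proj₂ (cover (from y))) (trans (reflexive (≡.cong f eq)) (sym (proj₂ (cover (from y′)))))

  collision : ∀ {m} → q < m → (f : Fin m → Carrier) → ∃₂ λ i j → i Fin.< j × f i ≈ f j
  collision q<m f with pigeonhole q<m (to ∘ f)
  ... | i , j , i<j , eq = i , j , i<j , injective eq

module _ {a b r} {A : Set a} {B : Set b} {R : REL A B r}
         (_≟ᴬ_ : DecidableEquality A) (_≟ᴮ_ : DecidableEquality B)
         (functional : ∀ {x x′ y y′} → R x x′ → R y y′ → x ≡ y → x′ ≡ y′)
         (injective : ∀ {x x′ y y′} → R x x′ → R y y′ → x′ ≡ y′ → x ≡ y) where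

  deduplicate⁺ : ∀ {xs ys} → Pointwise R xs ys → Pointwise R (deduplicate _≟ᴬ_ xs) (deduplicate _≟ᴮ_ ys)
  deduplicate⁺ []       = []
  deduplicate⁺ (r ∷ rs) = r ∷ Pointwise.filter⁺ (¬? ∘ (_ ≟ᴬ_)) (¬? ∘ (_ ≟ᴮ_))
    (λ r′ x≢y x′≡y′ → x≢y (injective r r′ x′≡y′))
    (λ r′ x′≢y′ x≡y → x′≢y′ (functional r r′ x≡y))
    (deduplicate⁺ rs)

Γ : ℕ → ℕ → ℕ → ℕ → Vertex → ℕ
Γ n a z₁ z₂ v₀ = a
Γ n a z₁ z₂ v₁ = z₁
Γ n a z₁ z₂ v₂ = z₂
Γ n a z₁ z₂ v₃ = neg n z₂
Γ n a z₁ z₂ v₄ = neg n z₁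
Γ n a z₁ z₂ v₅ = neg n a

2^n≡2*2^[n∸1] : ∀ {n} → 1 ≤ n → 2 ℕ.^ n ≡ 2 * 2 ℕ.^ (n ∸ 1)
2^n≡2*2^[n∸1] {suc n} _ = ≡.refl

%′-< : ∀ {d} → 0 < d → ∀ m → m %′ d < d
%′-< {suc d} _ m = m%n<n m (suc d)

module _ {c ℓ} (F : CommutativeRing c ℓ) where
  open CommutativeRing F renaming (_+_ to _⊕_; _*_ to _·_)
  open import Algebra.Properties.Semiring.Exp semiring using (_^_; ^-congˡ; ^-homo-*; ^-assocʳ)
  open import Algebra.Properties.CommutativeSemiring.Exp commutativeSemiring using (^-distrib-*)
  open import Algebra.Properties.CommutativeSemigroup *-commutativeSemigroup using (x∙yz≈y∙xz)
  open import Algebra.Properties.Ring ring using (-1*x≈-x; -‿involutive; +-identityˡ-unique; +-identityʳ-unique)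
  open import Relation.Binary.Reasoning.Setoid setoid

  pow≡^ : ∀ x m → pow F x m ≡ x ^ m
  pow≡^ x zero    = ≡.refl
  pow≡^ x (suc m) = ≡.cong (x ·_) (pow≡^ x m)

  1^≈1 : ∀ m → 1# ^ m ≈ 1#
  1^≈1 zero    = refl
  1^≈1 (suc m) = trans (*-identityˡ _) (1^≈1 m)

  ^-%′ : ∀ x d → x ^ d ≈ 1# → ∀ m → x ^ m ≈ x ^ (m %′ d)
  ^-%′ x zero    _    m = refl
  ^-%′ x (suc d) xᵈ≈1 m = begin
    x ^ m                    ≡⟨ ≡.cong (x ^_) m≡r+[1+d]t ⟩
    x ^ (r + suc d * t)      ≈⟨ ^-homo-* x r (suc d * t) ⟩
    x ^ r · x ^ (suc d * t)  ≈⟨ *-congˡ (^-assocʳ x (suc d) t) ⟨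
    x ^ r · (x ^ suc d) ^ t  ≈⟨ *-congˡ (trans (^-congˡ t xᵈ≈1) (1^≈1 t)) ⟩
    x ^ r · 1#               ≈⟨ *-identityʳ _ ⟩
    x ^ r                    ∎
    where
    r : ℕ
    r = m % suc d
    t : ℕ
    t = m / suc d
    m≡r+[1+d]t : m ≡ r + suc d * t
    m≡r+[1+d]t = ≡.trans (m≡m%n+[m/n]*n m (suc d)) (≡.cong (r +_) (ℕ.*-comm t (suc d)))

  ·-1⊕ : ∀ x y → x · (1# ⊕ y) ≈ x ⊕ x · y
  ·-1⊕ x y = trans (distribˡ x 1# y) (+-congʳ (*-identityʳ x))

  module Field (isField : IsField F) where
    open IsField isField

    invertible⇒≉0 : ∀ {x y} → x · y ≈ 1# → ¬ x ≈ 0#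
    invertible⇒≉0 {x} {y} xy≈1 x≈0 = 0≉1 (begin
      0#     ≈⟨ zeroˡ y ⟨
      0# · y ≈⟨ *-congʳ x≈0 ⟨
      x · y  ≈⟨ xy≈1 ⟩
      1#     ∎)

    *-cancelˡ : ∀ {x y z} → ¬ x ≈ 0# → x · y ≈ x · z → y ≈ z
    *-cancelˡ {x} {y} {z} x≉0 xy≈xz with inverse x x≉0
    ... | x⁻¹ , xx⁻¹≈1 = begin
      y               ≈⟨ undo y ⟨
      x⁻¹ · (x · y)   ≈⟨ *-congˡ xy≈xz ⟩
      x⁻¹ · (x · z)   ≈⟨ undo z ⟩
      z               ∎
      where
      undo : ∀ w → x⁻¹ · (x · w) ≈ w
      undo w = begin
        x⁻¹ · (x · w) ≈⟨ *-assoc x⁻¹ x w ⟨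
        (x⁻¹ · x) · w ≈⟨ *-congʳ (trans (*-comm x⁻¹ x) xx⁻¹≈1) ⟩
        1# · w        ≈⟨ *-identityˡ w ⟩
        w             ∎

    inverse-unique : ∀ {x y z} → x · y ≈ 1# → x · z ≈ 1# → y ≈ z
    inverse-unique xy≈1 xz≈1 = *-cancelˡ (invertible⇒≉0 xy≈1) (trans xy≈1 (sym xz≈1))

    ·-nonzero : ∀ {x y} → ¬ x ≈ 0# → ¬ y ≈ 0# → ¬ x · y ≈ 0#
    ·-nonzero x≉0 y≉0 xy≈0 = y≉0 (*-cancelˡ x≉0 (trans xy≈0 (sym (zeroʳ _))))

    module CharacteristicTwo (1⊕1≈0 : 1# ⊕ 1# ≈ 0#) where
      open import Algebra.Solver.Ring.NaturalCoefficients.Default commutativeSemiring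

      x⊕x≈0 : ∀ x → x ⊕ x ≈ 0#
      x⊕x≈0 x = begin
        x ⊕ x           ≈⟨ +-cong (*-identityˡ x) (*-identityˡ x) ⟨
        1# · x ⊕ 1# · x ≈⟨ distribʳ x 1# 1# ⟨
        (1# ⊕ 1#) · x   ≈⟨ *-congʳ 1⊕1≈0 ⟩
        0# · x          ≈⟨ zeroˡ x ⟩
        0#              ∎

      ⊕-transpose : ∀ {x y z} → x ⊕ y ≈ z → y ≈ x ⊕ z
      ⊕-transpose {x} {y} {z} x⊕y≈z = begin
        y             ≈⟨ +-identityˡ y ⟨
        0# ⊕ y        ≈⟨ +-congʳ (x⊕x≈0 x) ⟨
        (x ⊕ x) ⊕ y   ≈⟨ +-assoc x x y ⟩
        x ⊕ (x ⊕ y)   ≈⟨ +-congˡ x⊕y≈z ⟩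
        x ⊕ z         ∎

      x≉1⊕x : ∀ x → ¬ x ≈ 1# ⊕ x
      x≉1⊕x x x≈1⊕x = 0≉1 (sym (+-identityˡ-unique 1# x (sym x≈1⊕x)))

      square-⊕ : ∀ x y → (x ⊕ y) · (x ⊕ y) ≈ x · x ⊕ y · y
      square-⊕ x y = begin
        (x ⊕ y) · (x ⊕ y)                   ≈⟨ solve 2 (λ x y → (x :+ y) :* (x :+ y) := (x :* x :+ y :* y) :+ (x :* y :+ x :* y)) refl x y ⟩
        (x · x ⊕ y · y) ⊕ (x · y ⊕ x · y)   ≈⟨ +-congˡ (x⊕x≈0 (x · y)) ⟩
        (x · x ⊕ y · y) ⊕ 0#                ≈⟨ +-identityʳ _ ⟩
        x · x ⊕ y · y                       ∎

      frob : ℕ → Carrier → Carrier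
      frob i x = x ^ (2 ℕ.^ i)

      frob-cong : ∀ i {x y} → x ≈ y → frob i x ≈ frob i y
      frob-cong i = ^-congˡ (2 ℕ.^ i)

      frob-suc : ∀ i x → frob (suc i) x ≈ frob i x · frob i x
      frob-suc i x = begin
        x ^ (2 ℕ.^ i + (2 ℕ.^ i + 0))  ≈⟨ ^-homo-* x (2 ℕ.^ i) _ ⟩
        frob i x · x ^ (2 ℕ.^ i + 0)   ≡⟨ ≡.cong (λ e → frob i x · x ^ e) (ℕ.+-identityʳ (2 ℕ.^ i)) ⟩
        frob i x · frob i x            ∎

      frob-⊕ : ∀ i x y → frob i (x ⊕ y) ≈ frob i x ⊕ frob i y
      frob-⊕ zero x y = trans (*-identityʳ _) (+-cong (sym (*-identityʳ x)) (sym (*-identityʳ y)))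
      frob-⊕ (suc i) x y = begin
        frob (suc i) (x ⊕ y)                                 ≈⟨ frob-suc i (x ⊕ y) ⟩
        frob i (x ⊕ y) · frob i (x ⊕ y)                      ≈⟨ *-cong (frob-⊕ i x y) (frob-⊕ i x y) ⟩
        (frob i x ⊕ frob i y) · (frob i x ⊕ frob i y)        ≈⟨ square-⊕ (frob i x) (frob i y) ⟩
        frob i x · frob i x ⊕ frob i y · frob i y            ≈⟨ +-cong (frob-suc i x) (frob-suc i y) ⟨
        frob (suc i) x ⊕ frob (suc i) y                      ∎

      frob-· : ∀ i x y → frob i (x · y) ≈ frob i x · frob i y
      frob-· i x y = ^-distrib-* x y (2 ℕ.^ i)

      frob-1 : ∀ i → frob i 1# ≈ 1#
      frob-1 i = 1^≈1 (2 ℕ.^ i)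

      frob-^ : ∀ i x m → frob i (x ^ m) ≈ x ^ (2 ℕ.^ i * m)
      frob-^ i x m = trans (^-assocʳ x m (2 ℕ.^ i)) (reflexive (≡.cong (x ^_) (ℕ.*-comm m (2 ℕ.^ i))))

      frob-frob : ∀ i j x → frob i (frob j x) ≈ frob (i + j) x
      frob-frob i j x = trans (frob-^ i x (2 ℕ.^ j)) (reflexive (≡.cong (x ^_) (≡.sym (ℕ.^-distribˡ-+-* 2 i j))))

      Edge : Colour → Carrier → Carrier → Set ℓ
      Edge add-one x y = y ≈ 1# ⊕ x
      Edge invert  x y = x · y ≈ 1#

      Edge-sym : ∀ c {x y} → Edge c x y → Edge c y x
      Edge-sym add-one y≈1⊕x = ⊕-transpose (sym y≈1⊕x)
      Edge-sym invert  xy≈1  = trans (*-comm _ _) xy≈1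

      Edge-functional : ∀ c {x y z} → Edge c x y → Edge c x z → y ≈ z
      Edge-functional add-one y≈1⊕x z≈1⊕x = trans y≈1⊕x (sym z≈1⊕x)
      Edge-functional invert  xy≈1  xz≈1  = inverse-unique xy≈1 xz≈1

      Edge-resp : ∀ c {x x′ y y′} → x ≈ x′ → y ≈ y′ → Edge c x y → Edge c x′ y′
      Edge-resp add-one x≈x′ y≈y′ y≈1⊕x = trans (sym y≈y′) (trans y≈1⊕x (+-congˡ x≈x′))
      Edge-resp invert  x≈x′ y≈y′ xy≈1  = trans (*-cong (sym x≈x′) (sym y≈y′)) xy≈1

      Edge-frob : ∀ c i {x y} → Edge c x y → Edge c (frob i x) (frob i y)
      Edge-frob add-one i {x} y≈1⊕x = trans (frob-cong i y≈1⊕x) (trans (frob-⊕ i 1# x) (+-congʳ (frob-1 i)))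
      Edge-frob invert  i {x} {y} xy≈1 = trans (sym (frob-· i x y)) (trans (frob-cong i xy≈1) (frob-1 i))

      hexagon-closes : ∀ {x y x′ z y′ z′} → Edge add-one x y → Edge invert x x′ → Edge add-one x′ z →
                       Edge invert y y′ → Edge invert z z′ → Edge add-one y′ z′
      hexagon-closes {x} {y} {x′} {z} {y′} {z′} y≈1⊕x xx′≈1 z≈1⊕x′ yy′≈1 zz′≈1 =
        inverse-unique zz′≈1 (*-cancelˡ (invertible⇒≉0 yy′≈1) (begin
          y · (z · (1# ⊕ y′)) ≈⟨ x∙yz≈y∙xz y z _ ⟩
          z · (y · (1# ⊕ y′)) ≈⟨ *-congˡ (trans (·-1⊕ y y′) (+-congˡ yy′≈1)) ⟩
          z · (y ⊕ 1#)        ≈⟨ *-congˡ (trans (+-comm y 1#) (sym (Edge-sym add-one y≈1⊕x))) ⟩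
          z · x               ≈⟨ *-comm z x ⟩
          x · z               ≈⟨ *-congˡ z≈1⊕x′ ⟩
          x · (1# ⊕ x′)       ≈⟨ trans (·-1⊕ x x′) (+-congˡ xx′≈1) ⟩
          x ⊕ 1#              ≈⟨ trans (+-comm x 1#) (sym y≈1⊕x) ⟩
          y                   ≈⟨ *-identityʳ y ⟨
          y · 1#              ∎))

      module Hexagon (k : ℕ) (fermat : ∀ x → frob (6 * k + 1) x ≈ x) (U : Vertex → Carrier)
                     (hexagon : ∀ c v → Edge c (U v) (U (step c v))) where

        n : ℕ
        n = 6 * k + 1

        fermat-iterated : ∀ r x → frob (r * n) x ≈ x
        fermat-iterated zero    x = *-identityʳ x
        fermat-iterated (suc r) x = begin
          frob (n + r * n) x     ≈⟨ frob-frob n (r * n) x ⟨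
          frob n (frob (r * n) x) ≈⟨ frob-cong n (fermat-iterated r x) ⟩
          frob n x               ≈⟨ fermat x ⟩
          x                      ∎

        frob-walk : ∀ i w {x y} → frob i (U x) ≈ U y → frob i (U (walk w x)) ≈ U (walk w y)
        frob-walk i []      e = e
        frob-walk i (c ∷ w) {x} {y} e = frob-walk i w
          (Edge-functional c (Edge-frob c i (hexagon c x)) (Edge-resp c (sym e) refl (hexagon c y)))

        frob-acts-by-symmetry : ∀ i {p} → frob i (U v₀) ≈ U p → ∀ v → frob i (U v) ≈ U (symmetry p v)
        frob-acts-by-symmetry i e v =
          ≡.subst (λ u → frob i (U u) ≈ U (symmetry _ v)) (walk-path v) (frob-walk i (path v) e)

        frob-iterated : ∀ i {p} → frob i (U v₀) ≈ U p → ∀ r → frob (r * i) (U v₀) ≈ U ((symmetry p ^ᵛ r) v₀)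
        frob-iterated i e zero    = *-identityʳ _
        frob-iterated i {p} e (suc r) = begin
          frob (i + r * i) (U v₀)              ≈⟨ frob-frob i (r * i) (U v₀) ⟨
          frob i (frob (r * i) (U v₀))         ≈⟨ frob-cong i (frob-iterated i e r) ⟩
          frob i (U ((symmetry p ^ᵛ r) v₀))    ≈⟨ frob-acts-by-symmetry i e _ ⟩
          U (symmetry p ((symmetry p ^ᵛ r) v₀)) ∎

        frob-fixes-U₀ : ∀ i {p} → frob i (U v₀) ≈ U p → U v₀ ≈ U p
        frob-fixes-U₀ i {p} e = begin
          U v₀                              ≈⟨ fermat-iterated i (U v₀) ⟨
          frob (i * n) (U v₀)               ≡⟨ ≡.cong (λ m → frob m (U v₀)) (ℕ.*-comm i n) ⟩
          frob (n * i) (U v₀)               ≈⟨ frob-iterated i e n ⟩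
          U ((symmetry p ^ᵛ n) v₀)          ≡⟨ ≡.cong U (symmetry-period p k) ⟩
          U p                               ∎

        A : Carrier
        A = U v₀

        U≉0 : ∀ v → ¬ U v ≈ 0#
        U≉0 v = invertible⇒≉0 (hexagon invert v)

        A·U₂≈A⊕1 : A · U v₂ ≈ A ⊕ 1#
        A·U₂≈A⊕1 = trans (*-congˡ (hexagon add-one v₅)) (trans (·-1⊕ A _) (+-congˡ (hexagon invert v₀)))

        A≉U₁ : ¬ A ≈ U v₁
        A≉U₁ e = x≉1⊕x A (trans e (hexagon add-one v₀))

        -- A · A = 1 + A would mean σ(A) = U v₁.
        A·A≉1⊕A : ¬ A · A ≈ 1# ⊕ A
        A·A≉1⊕A e = A≉U₁ (frob-fixes-U₀ 1 (begin
          A · (A · 1#) ≈⟨ *-congˡ (*-identityʳ A) ⟩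
          A · A        ≈⟨ e ⟩
          1# ⊕ A       ≈⟨ hexagon add-one v₀ ⟨
          U v₁         ∎))

        no-fixed-vertex : ∀ p → A ≈ U p → p ≡ v₀
        no-fixed-vertex v₀ _ = ≡.refl
        no-fixed-vertex v₁ e = ⊥-elim (A≉U₁ e)
        no-fixed-vertex v₂ e = ⊥-elim (A·A≉1⊕A (trans (*-congˡ e) (trans A·U₂≈A⊕1 (+-comm A 1#))))
        no-fixed-vertex v₃ e = ⊥-elim (U≉0 v₀ (+-identityʳ-unique 1# A (begin
          1# ⊕ A          ≈⟨ +-comm 1# A ⟩
          A ⊕ 1#          ≈⟨ A·U₂≈A⊕1 ⟨
          A · U v₂        ≈⟨ *-comm A _ ⟩
          U v₂ · A        ≈⟨ *-congˡ e ⟩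
          U v₂ · U v₃     ≈⟨ hexagon invert v₂ ⟩
          1#              ∎)))
        no-fixed-vertex v₄ e = ⊥-elim (A·A≉1⊕A (trans (⊕-transpose (begin
          A ⊕ A · A       ≈⟨ ·-1⊕ A A ⟨
          A · (1# ⊕ A)    ≈⟨ *-cong e (sym (hexagon add-one v₀)) ⟩
          U v₄ · U v₁     ≈⟨ Edge-sym invert (hexagon invert v₁) ⟩
          1#              ∎)) (+-comm A 1#)))
        no-fixed-vertex v₅ e = ⊥-elim (·-nonzero (U≉0 v₁) (U≉0 v₁) (begin
          U v₁ · U v₁           ≈⟨ *-cong (hexagon add-one v₀) (hexagon add-one v₀) ⟩
          (1# ⊕ A) · (1# ⊕ A)   ≈⟨ square-⊕ 1# A ⟩
          1# · 1# ⊕ A · A       ≈⟨ +-cong (*-identityˡ 1#) (trans (*-congˡ e) (hexagon invert v₀)) ⟩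
          1# ⊕ 1#               ≈⟨ 1⊕1≈0 ⟩
          0#                    ∎))

        frob-separates : ∀ i {j l} → frob i (U j) ≈ U l → j ≡ l
        frob-separates i {j} {l} e = walk-injective back (≡.trans (walk-reverse-path j) (≡.sym back-l≡v₀))
          where
          back : List Colour
          back = reverse (path j)
          back-l≡v₀ : walk back l ≡ v₀
          back-l≡v₀ = no-fixed-vertex _ (frob-fixes-U₀ i
            (≡.subst (λ u → frob i (U u) ≈ U (walk back l)) (walk-reverse-path j) (frob-walk i back e)))

    module FiniteField {q} (size : HasSize F q) (3≤q : 3 ≤ q)
                       (ξ : Carrier) (ξ-primitive : IsPrimitive F ξ) where
      open FiniteSetoid size renaming (_≟_ to _≈?_)

      N : ℕ
      N = q ∸ 1

      q≡1+N : q ≡ suc N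
      q≡1+N = ≡.sym (≡.trans (ℕ.+-comm 1 N) (ℕ.m∸n+n≡m (ℕ.≤-trans (s≤s z≤n) 3≤q)))

      0<N : 0 < N
      0<N = ℕ.≤-trans (s≤s z≤n) (ℕ.∸-monoˡ-≤ 1 3≤q)

      log : ∀ x → ¬ x ≈ 0# → ∃ λ i → x ≈ ξ ^ i
      log x x≉0 with ξ-primitive x x≉0
      ... | i , x≈ξⁱ = i , trans x≈ξⁱ (reflexive (pow≡^ ξ i))

      powers-cover : ∀ {m} → (∀ x → ¬ x ≈ 0# → ∃ λ i → i < m × x ≈ ξ ^ i) → q ≤ suc m
      powers-cover {m} bounded-log = size≤cover f cover
        where
        f : Fin (suc m) → Carrier
        f Fin.zero    = 0#
        f (Fin.suc j) = ξ ^ toℕ j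
        cover : ∀ x → ∃ λ j → x ≈ f j
        cover x with x ≈? 0#
        ... | yes x≈0 = Fin.zero , x≈0
        ... | no  x≉0 with bounded-log x x≉0
        ...   | i , i<m , x≈ξⁱ =
          Fin.suc (fromℕ< i<m) , trans x≈ξⁱ (reflexive (≡.cong (ξ ^_) (≡.sym (toℕ-fromℕ< i<m))))

      ξ≉0 : ¬ ξ ≈ 0#
      ξ≉0 ξ≈0 = ℕ.<⇒≱ 3≤q (powers-cover log-below-1)
        where
        log-below-1 : ∀ x → ¬ x ≈ 0# → ∃ λ i → i < 1 × x ≈ ξ ^ i
        log-below-1 x x≉0 with log x x≉0
        ... | zero  , x≈1    = 0 , s≤s z≤n , x≈1
        ... | suc i , x≈ξξⁱ = ⊥-elim (x≉0 (trans x≈ξξⁱ (trans (*-congʳ ξ≈0) (zeroˡ _))))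

      ξ^≉0 : ∀ m → ¬ ξ ^ m ≈ 0#
      ξ^≉0 zero    = 0≉1 ∘ sym
      ξ^≉0 (suc m) = ·-nonzero ξ≉0 (ξ^≉0 m)

      order-≥ : ∀ {d} → 0 < d → ξ ^ d ≈ 1# → N ≤ d
      order-≥ {d} 0<d ξᵈ≈1 = ℕ.≤-pred (≡.subst (_≤ suc d) q≡1+N (powers-cover log-below-d))
        where
        log-below-d : ∀ x → ¬ x ≈ 0# → ∃ λ i → i < d × x ≈ ξ ^ i
        log-below-d x x≉0 with log x x≉0
        ... | i , x≈ξⁱ = i %′ d , %′-< 0<d i , trans x≈ξⁱ (^-%′ ξ d ξᵈ≈1 i)

      ξ^-cancel : ∀ {i j} → i ≤ j → ξ ^ i ≈ ξ ^ j → ξ ^ (j ∸ i) ≈ 1#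
      ξ^-cancel {i} {j} i≤j ξⁱ≈ξʲ = *-cancelˡ (ξ^≉0 i) (begin
        ξ ^ i · ξ ^ (j ∸ i)  ≈⟨ ^-homo-* ξ i (j ∸ i) ⟨
        ξ ^ (i + (j ∸ i))    ≡⟨ ≡.cong (ξ ^_) (ℕ.m+[n∸m]≡n i≤j) ⟩
        ξ ^ j                ≈⟨ ξⁱ≈ξʲ ⟨
        ξ ^ i                ≈⟨ *-identityʳ _ ⟨
        ξ ^ i · 1#           ∎)

      period≤N : ∃ λ d → 0 < d × d ≤ N × ξ ^ d ≈ 1#
      period≤N with collision (ℕ.n<1+n q) f
        where
        f : Fin (suc q) → Carrier
        f Fin.zero    = 0#
        f (Fin.suc j) = ξ ^ toℕ j
      ... | Fin.zero  , Fin.zero  , () , _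
      ... | Fin.zero  , Fin.suc j , _  , 0≈ξʲ = ⊥-elim (ξ^≉0 (toℕ j) (sym 0≈ξʲ))
      ... | Fin.suc i , Fin.zero  , () , _
      ... | Fin.suc i , Fin.suc j , s≤s i<j , ξⁱ≈ξʲ =
        toℕ j ∸ toℕ i , ℕ.m<n⇒0<n∸m i<j , ℕ.≤-trans (ℕ.m∸n≤m (toℕ j) (toℕ i)) j≤N , ξ^-cancel (ℕ.<⇒≤ i<j) ξⁱ≈ξʲ
        where
        j≤N : toℕ j ≤ N
        j≤N = ℕ.≤-pred (≡.subst (toℕ j <_) q≡1+N (toℕ<n j))

      ξ^N≈1 : ξ ^ N ≈ 1#
      ξ^N≈1 with period≤N
      ... | d , 0<d , d≤N , ξᵈ≈1 = ≡.subst (λ e → ξ ^ e ≈ 1#) (ℕ.≤-antisym d≤N (order-≥ 0<d ξᵈ≈1)) ξᵈ≈1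

      short-period : ∀ {i j} → i < j → j < N → ¬ ξ ^ i ≈ ξ ^ j
      short-period {i} {j} i<j j<N ξⁱ≈ξʲ = ℕ.<⇒≱ j<N (ℕ.≤-trans
        (order-≥ (ℕ.m<n⇒0<n∸m i<j) (ξ^-cancel (ℕ.<⇒≤ i<j) ξⁱ≈ξʲ)) (ℕ.m∸n≤m j i))

      ξ^-injective : ∀ {x y} → x < N → y < N → ξ ^ x ≈ ξ ^ y → x ≡ y
      ξ^-injective {x} {y} x<N y<N ξˣ≈ξʸ with ℕ.<-cmp x y
      ... | tri< x<y _ _ = ⊥-elim (short-period x<y y<N ξˣ≈ξʸ)
      ... | tri≈ _ x≡y _ = x≡y
      ... | tri> _ _ y<x = ⊥-elim (short-period y<x x<N (sym ξˣ≈ξʸ))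

      x^N≈1 : ∀ {x} → ¬ x ≈ 0# → x ^ N ≈ 1#
      x^N≈1 {x} x≉0 with log x x≉0
      ... | i , x≈ξⁱ = begin
        x ^ N         ≈⟨ ^-congˡ N x≈ξⁱ ⟩
        (ξ ^ i) ^ N   ≈⟨ ^-assocʳ ξ i N ⟩
        ξ ^ (i * N)   ≡⟨ ≡.cong (ξ ^_) (ℕ.*-comm i N) ⟩
        ξ ^ (N * i)   ≈⟨ ^-assocʳ ξ N i ⟨
        (ξ ^ N) ^ i   ≈⟨ ^-congˡ i ξ^N≈1 ⟩
        1# ^ i        ≈⟨ 1^≈1 i ⟩
        1#            ∎

      fermat : ∀ x → x ^ q ≈ x
      fermat x with x ≈? 0#
      ... | yes x≈0 = begin
        x ^ q         ≡⟨ ≡.cong (x ^_) q≡1+N ⟩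
        x · x ^ N     ≈⟨ *-congʳ x≈0 ⟩
        0# · x ^ N    ≈⟨ zeroˡ _ ⟩
        0#            ≈⟨ x≈0 ⟨
        x             ∎
      ... | no x≉0 = begin
        x ^ q         ≡⟨ ≡.cong (x ^_) q≡1+N ⟩
        x · x ^ N     ≈⟨ *-congˡ (x^N≈1 x≉0) ⟩
        x · 1#        ≈⟨ *-identityʳ x ⟩
        x             ∎

      characteristic-two : ∀ m → q ≡ 2 * m → 1# ⊕ 1# ≈ 0#
      characteristic-two m q≡2m = trans (+-congˡ (sym -1≈1)) (-‿inverseʳ 1#)
        where
        -1≈1 : - 1# ≈ 1#
        -1≈1 = begin
          - 1#                ≈⟨ fermat (- 1#) ⟨
          (- 1#) ^ q          ≡⟨ ≡.cong ((- 1#) ^_) q≡2m ⟩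
          (- 1#) ^ (2 * m)    ≈⟨ ^-assocʳ (- 1#) 2 m ⟨
          ((- 1#) ^ 2) ^ m    ≈⟨ ^-congˡ m (trans (*-congˡ (*-identityʳ _)) (trans (-1*x≈-x (- 1#)) (-‿involutive 1#))) ⟩
          1# ^ m              ≈⟨ 1^≈1 m ⟩
          1#                  ∎

    module Exponents {n} (2≤n : 2 ≤ n) (size : HasSize F (2 ℕ.^ n))
                     (ξ : Carrier) (ξ-primitive : IsPrimitive F ξ) where

      open FiniteField size (ℕ.≤-trans (ℕ.n≤1+n 3) (ℕ.^-monoʳ-≤ 2 2≤n)) ξ ξ-primitive public

      1⊕1≈0 : 1# ⊕ 1# ≈ 0#
      1⊕1≈0 = characteristic-two (2 ℕ.^ (n ∸ 1)) (2^n≡2*2^[n∸1] (ℕ.≤-trans (s≤s z≤n) 2≤n))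

      open CharacteristicTwo 1⊕1≈0 public

      cyc-< : ∀ a i → cyc n a i < N
      cyc-< a i = %′-< 0<N (2 ℕ.^ i * a)

      neg-< : ∀ a → neg n a < N
      neg-< a = %′-< 0<N (N ∸ a)

      ξ^cyc : ∀ a i → ξ ^ cyc n a i ≈ frob i (ξ ^ a)
      ξ^cyc a i = trans (sym (^-%′ ξ N ξ^N≈1 (2 ℕ.^ i * a))) (sym (frob-^ i ξ a))

      ξ^neg : ∀ {a} → a ≤ N → Edge invert (ξ ^ a) (ξ ^ neg n a)
      ξ^neg {a} a≤N = begin
        ξ ^ a · ξ ^ neg n a     ≈⟨ *-congˡ (^-%′ ξ N ξ^N≈1 (N ∸ a)) ⟨
        ξ ^ a · ξ ^ (N ∸ a)     ≈⟨ ^-homo-* ξ a (N ∸ a) ⟨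
        ξ ^ (a + (N ∸ a))       ≡⟨ ≡.cong (ξ ^_) (ℕ.m+[n∸m]≡n a≤N) ⟩
        ξ ^ N                   ≈⟨ ξ^N≈1 ⟩
        1#                      ∎

      InClass⇒frob : ∀ {x y} → InClass n x y → ∃ λ i → frob i (ξ ^ x) ≈ ξ ^ y
      InClass⇒frob {x} (i , y≡cyc) = i , trans (sym (ξ^cyc x i)) (reflexive (≡.cong (ξ ^_) (≡.sym y≡cyc)))

      classSize-edge : ∀ c {x y} → x < N → y < N → Edge c (ξ ^ x) (ξ ^ y) → classSize n x ≡ classSize n y
      classSize-edge c {x} {y} x<N y<N e = Pointwise-length
        (deduplicate⁺ {R = Related} ℕ._≟_ ℕ._≟_ functional injective
          (Pointwise.map⁺ (cyc n x) (cyc n y) (Pointwise.refl (λ {i} → related i) {upTo n})))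
        where
        Related : ℕ → ℕ → Set ℓ
        Related x′ y′ = x′ < N × y′ < N × Edge c (ξ ^ x′) (ξ ^ y′)
        related : ∀ i → Related (cyc n x i) (cyc n y i)
        related i = cyc-< x i , cyc-< y i , Edge-resp c (sym (ξ^cyc x i)) (sym (ξ^cyc y i)) (Edge-frob c i e)
        functional : ∀ {x x′ y y′} → Related x x′ → Related y y′ → x ≡ y → x′ ≡ y′
        functional (_ , x′<N , e₁) (_ , y′<N , e₂) ≡.refl = ξ^-injective x′<N y′<N (Edge-functional c e₁ e₂)
        injective : ∀ {x x′ y y′} → Related x x′ → Related y y′ → x′ ≡ y′ → x ≡ y
        injective (x<N , _ , e₁) (y<N , _ , e₂) ≡.refl =
          ξ^-injective x<N y<N (Edge-functional c (Edge-sym c e₁) (Edge-sym c e₂))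

    module ZechHexagon {k} (1≤k : 1 ≤ k) (size : HasSize F (2 ℕ.^ (6 * k + 1)))
                       (ξ : Carrier) (ξ-primitive : IsPrimitive F ξ) {a z₁ z₂ : ℕ}
                       (a<N : a < modulus (6 * k + 1))
                       (z₁<N : z₁ < modulus (6 * k + 1)) (z₂<N : z₂ < modulus (6 * k + 1))
                       (zech-a : 1# ⊕ pow F ξ a ≈ pow F ξ z₁)
                       (zech-−a : 1# ⊕ pow F ξ (neg (6 * k + 1) a) ≈ pow F ξ z₂) where

      n : ℕ
      n = 6 * k + 1

      open Exponents (ℕ.+-monoˡ-≤ 1 (ℕ.≤-trans 1≤k (ℕ.m≤n*m k 6))) size ξ ξ-primitive

      γ : Vertex → ℕ
      γ = Γ n a z₁ z₂

      U : Vertex → Carrier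
      U v = ξ ^ γ v

      γ-< : ∀ v → γ v < N
      γ-< v₀ = a<N
      γ-< v₁ = z₁<N
      γ-< v₂ = z₂<N
      γ-< v₃ = neg-< z₂
      γ-< v₄ = neg-< z₁
      γ-< v₅ = neg-< a

      zech⇒Edge : ∀ {x y} → 1# ⊕ pow F ξ x ≈ pow F ξ y → Edge add-one (ξ ^ x) (ξ ^ y)
      zech⇒Edge {x} {y} e = trans (reflexive (≡.sym (pow≡^ ξ y))) (trans (sym e) (+-congˡ (reflexive (pow≡^ ξ x))))

      U₀U₅ : Edge invert (U v₀) (U v₅)
      U₀U₅ = ξ^neg {a} (ℕ.<⇒≤ a<N)

      U₁U₄ : Edge invert (U v₁) (U v₄)
      U₁U₄ = ξ^neg {z₁} (ℕ.<⇒≤ z₁<N)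

      U₂U₃ : Edge invert (U v₂) (U v₃)
      U₂U₃ = ξ^neg {z₂} (ℕ.<⇒≤ z₂<N)

      U₀U₁ : Edge add-one (U v₀) (U v₁)
      U₀U₁ = zech⇒Edge {a} {z₁} zech-a

      U₅U₂ : Edge add-one (U v₅) (U v₂)
      U₅U₂ = zech⇒Edge {neg n a} {z₂} zech-−a

      U₄U₃ : Edge add-one (U v₄) (U v₃)
      U₄U₃ = hexagon-closes U₀U₁ U₀U₅ U₅U₂ U₁U₄ U₂U₃

      hexagon : ∀ c v → Edge c (U v) (U (step c v))
      hexagon add-one v₀ = U₀U₁
      hexagon add-one v₁ = Edge-sym add-one U₀U₁
      hexagon add-one v₂ = Edge-sym add-one U₅U₂
      hexagon add-one v₃ = Edge-sym add-one U₄U₃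
      hexagon add-one v₄ = U₄U₃
      hexagon add-one v₅ = U₅U₂
      hexagon invert  v₀ = U₀U₅
      hexagon invert  v₁ = U₁U₄
      hexagon invert  v₂ = U₂U₃
      hexagon invert  v₃ = Edge-sym invert U₂U₃
      hexagon invert  v₄ = Edge-sym invert U₁U₄
      hexagon invert  v₅ = Edge-sym invert U₀U₅

      open Hexagon k fermat U hexagon using (frob-separates)

      γ-distinct : ∀ {j l} → j ≢ l → ¬ InClass n (γ j) (γ l)
      γ-distinct j≢l in-class with InClass⇒frob in-class
      ... | i , e = j≢l (frob-separates i e)

      classSize-walk : ∀ w v → classSize n (γ (walk w v)) ≡ classSize n (γ v)
      classSize-walk []      v = ≡.refl
      classSize-walk (c ∷ w) v = ≡.trans (classSize-walk w (step c v))
        (≡.sym (classSize-edge c (γ-< v) (γ-< (step c v)) (hexagon c v)))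

      γ-classSize : ∀ v → classSize n (γ v) ≡ classSize n a
      γ-classSize v = ≡.subst (λ u → classSize n (γ u) ≡ classSize n a) (walk-path v) (classSize-walk (path v) v₀)

open import Data.Nat using (_^_)

corollary3 : ∀ {c ℓ : Level} (k : ℕ) → 1 ≤ k →
    (F : CommutativeRing c ℓ) → IsField F → HasSize F (2 ^ (6 * k + 1)) →
    (ξ : CommutativeRing.Carrier F) → IsPrimitive F ξ →
    ∀ (a z₁ z₂ : ℕ) →
    a < modulus (6 * k + 1) → a ≢ 0 →
    z₁ < modulus (6 * k + 1) → z₂ < modulus (6 * k + 1) →
    CommutativeRing._≈_ F (CommutativeRing._+_ F (CommutativeRing.1# F) (pow F ξ a)) (pow F ξ z₁) →
    CommutativeRing._≈_ F (CommutativeRing._+_ F (CommutativeRing.1# F) (pow F ξ (neg (6 * k + 1) a))) (pow F ξ z₂) →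
    AllPairs (λ x y → ¬ InClass (6 * k + 1) x y)
      (a ∷ z₁ ∷ z₂ ∷ neg (6 * k + 1) z₂ ∷ neg (6 * k + 1) z₁ ∷ neg (6 * k + 1) a ∷ [])
    × All (λ x → classSize (6 * k + 1) x ≡ classSize (6 * k + 1) a)
      (a ∷ z₁ ∷ z₂ ∷ neg (6 * k + 1) z₂ ∷ neg (6 * k + 1) z₁ ∷ neg (6 * k + 1) a ∷ [])
corollary3 k 1≤k F isField size ξ ξ-primitive a z₁ z₂ a<N _ z₁<N z₂<N zech-a zech-−a =
  tabulate⁺ γ-distinct , All.tabulate⁺ γ-classSize
  where
  open Field.ZechHexagon F isField 1≤k size ξ ξ-primitive a<N z₁<N z₂<N zech-a zech-−a
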